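{- Let $\Phi=\mathcal{Q}.\,\varphi$ be a QPTL formula, where $\mathcal{Q}$ is a prefix of path quantifiers and $\varphi$ is a syntactically co-safe LTL formula (in negation normal form). If $\mathit{qbf}(\Phi,0,k)$ is satisfiable for some $k>0$, then $\Phi$ is satisfiable.
   Context: QPTL is LTL extended with $\exists p.\chi$ (true at position $i$ of $w$ iff some $w'$ differing from $w$ at most in $p$ satisfies $\chi$ at $i$) and $\forall p.\chi:=\neg\exists p.\neg\chi$; satisfiable means satisfied at position $0$ by some word. Syntactically co-safe LTL formulas are generated by $\varphi::=x\mid\neg x\mid\varphi\vee\varphi\mid\varphi\wedge\varphi\mid\mathsf{X}\varphi\mid\mathsf{F}\varphi\mid\varphi\,\mathsf{U}\,\varphi$, with $\mathsf{F}\varphi=\mathsf{true}\,\mathsf{U}\,\varphi$. The $k$-unrolling into a quantified Boolean formula: each proposition $p$ gives Boolean variables $p_0,\dots,p_{k-1}$; $\mathit{qbf}(p,i,k)=p_i$, $\mathit{qbf}(\neg p,i,k)=\neg p_i$, $\mathit{qbf}(\chi\circ\chi',i,k)=\mathit{qbf}(\chi,i,k)\circ\mathit{qbf}(\chi',i,k)$ for $\circ\in\{\vee,\wedge\}$, $\mathit{qbf}(\mathsf{X}\chi,i,k)=\mathit{qbf}(\chi,i+1,k)$ if $i+1<k$ and $\mathsf{false}$ otherwise, $\mathit{qbf}(\chi\,\mathsf{U}\,\chi',i,k)=\mathit{qbf}(\chi',i,k)\vee(\mathit{qbf}(\chi,i,k)\wedge\mathit{qbf}(\chi\,\mathsf{U}\,\chi',i+1,k))$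 if $i<k$ and $\mathsf{false}$ otherwise, and $\mathit{qbf}(Q\,p.\chi,i,k)=Q\,p_0,\dots,p_{k-1}.\,\mathit{qbf}(\chi,i,k)$ for $Q\in\{\exists,\forall\}$. A QBF is satisfiable if some assignment to its free variables makes it true. -}

module Defs where

open import Data.Nat using (ℕ; zero; suc; _≤_; _<_; _∸_; _≟_; _<?_)
open import Data.Bool using (Bool; true; false; _∧_; _∨_; not; if_then_else_)
open import Data.Product using (Σ; _×_; _,_; ∃-syntax)
open import Data.Sum using (_⊎_)
open import Data.Unit using (⊤)
open import Data.Empty using (⊥)
open import Data.List using (List; []; _∷_)
open import Relation.Nullary using (¬_; does; yes; no)
open import Relation.Binary.PropositionalEquality using (_≡_; _≢_)

Prop : Set
Prop = ℕ

Word : Set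
Word = ℕ → Prop → Bool

data QPTL : Set where
  tt   : QPTL
  var  : Prop → QPTL
  neg  : QPTL → QPTL
  _∨Q_ : QPTL → QPTL → QPTL
  _∧Q_ : QPTL → QPTL → QPTL
  Xq   : QPTL → QPTL
  _Uq_ : QPTL → QPTL → QPTL
  ∃q   : Prop → QPTL → QPTL

∀q : Prop → QPTL → QPTL
∀q p χ = neg (∃q p (neg χ))

AgreeExcept : Prop → Word → Word → Set
AgreeExcept p w w' = ∀ i q → q ≢ p → w' i q ≡ w i q

_,_⊨_ : Word → ℕ → QPTL → Set
w , i ⊨ tt = ⊤
w , i ⊨ var p = w i p ≡ true
w , i ⊨ neg χ = ¬ (w , i ⊨ χ)
w , i ⊨ (χ ∨Q χ') = (w , i ⊨ χ) ⊎ (w , i ⊨ χ')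
w , i ⊨ (χ ∧Q χ') = (w , i ⊨ χ) × (w , i ⊨ χ')
w , i ⊨ Xq χ = w , suc i ⊨ χ
w , i ⊨ (χ Uq χ') =
  ∃[ j ] (i ≤ j × (w , j ⊨ χ') × (∀ m → i ≤ m → m < j → w , m ⊨ χ))
w , i ⊨ ∃q p χ = ∃[ w' ] (AgreeExcept p w w' × (w' , i ⊨ χ))

Satisfiable : QPTL → Set
Satisfiable Φ = ∃[ w ] (w , 0 ⊨ Φ)

data CoSafe : Set where
  ctrue : CoSafe
  pos   : Prop → CoSafe
  negp  : Prop → CoSafe
  _∨C_  : CoSafe → CoSafe → CoSafe
  _∧C_  : CoSafe → CoSafe → CoSafe
  XC    : CoSafe → CoSafe
  _UC_  : CoSafe → CoSafe → CoSafe

FC : CoSafe → CoSafe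
FC φ = ctrue UC φ

data Quant : Set where
  ∃Q ∀Q : Quant

Prefix : Set
Prefix = List (Quant × Prop)

toQPTL : CoSafe → QPTL
toQPTL ctrue = tt
toQPTL (pos p) = var p
toQPTL (negp p) = neg (var p)
toQPTL (φ ∨C ψ) = toQPTL φ ∨Q toQPTL ψ
toQPTL (φ ∧C ψ) = toQPTL φ ∧Q toQPTL ψ
toQPTL (XC φ) = Xq (toQPTL φ)
toQPTL (φ UC ψ) = toQPTL φ Uq toQPTL ψ

prenex : Prefix → CoSafe → QPTL
prenex [] φ = toQPTL φ
prenex ((_,_ ∃Q p) ∷ 𝒬) φ = ∃q p (prenex 𝒬 φ)
prenex ((_,_ ∀Q p) ∷ 𝒬) φ = ∀q p (prenex 𝒬 φ)

-- Quantified Boolean formulas; Boolean variable p_i is the pair (p , i)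

data QBF : Set where
  bconst : Bool → QBF
  bvar   : Prop → ℕ → QBF
  bneg   : Prop → ℕ → QBF
  _∨B_   : QBF → QBF → QBF
  _∧B_   : QBF → QBF → QBF
  ∃B ∀B  : Prop → ℕ → QBF → QBF

Assignment : Set
Assignment = Prop → ℕ → Bool

update : Assignment → Prop → ℕ → Bool → Assignment
update ρ p i b q j =
  if does (q ≟ p) ∧ does (j ≟ i) then b else ρ q j

eval : QBF → Assignment → Bool
eval (bconst b) ρ = b
eval (bvar p i) ρ = ρ p i
eval (bneg p i) ρ = not (ρ p i)
eval (β ∨B γ) ρ = eval β ρ ∨ eval γ ρ
eval (β ∧B γ) ρ = eval β ρ ∧ eval γ ρ
eval (∃B p i β) ρ = eval β (update ρ p i true) ∨ eval β (update ρ p i false)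
eval (∀B p i β) ρ = eval β (update ρ p i true) ∧ eval β (update ρ p i false)

QBFSatisfiable : QBF → Set
QBFSatisfiable β = ∃[ ρ ] (eval β ρ ≡ true)

-- qbf(χ U χ', i, k) with fuel n = k ∸ i
unrollU : (ℕ → QBF) → (ℕ → QBF) → ℕ → ℕ → QBF
unrollU f f' zero i = bconst false
unrollU f f' (suc n) i = f' i ∨B (f i ∧B unrollU f f' n (suc i))

qbfX : QBF → ℕ → ℕ → QBF
qbfX β i k with suc i <? k
... | yes _ = β
... | no _ = bconst false

qbfφ : CoSafe → ℕ → ℕ → QBF
qbfφ ctrue i k = bconst true
qbfφ (pos p) i k = bvar p i
qbfφ (negp p) i k = bneg p i
qbfφ (φ ∨C ψ) i k = qbfφ φ i k ∨B qbfφ ψ i k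
qbfφ (φ ∧C ψ) i k = qbfφ φ i k ∧B qbfφ ψ i k
qbfφ (XC φ) i k = qbfX (qbfφ φ (suc i) k) i k
qbfφ (φ UC ψ) i k = unrollU (λ j → qbfφ φ j k) (λ j → qbfφ ψ j k) (k ∸ i) i

quantAll : Quant → Prop → ℕ → QBF → QBF
quantAll q p zero β = β
quantAll ∃Q p (suc n) β = ∃B p n (quantAll ∃Q p n β)
quantAll ∀Q p (suc n) β = ∀B p n (quantAll ∀Q p n β)

qbf : Prefix → CoSafe → ℕ → ℕ → QBF
qbf [] φ i k = qbfφ φ i k
qbf ((_,_ q p) ∷ 𝒬) φ i k = quantAll q p k (qbf 𝒬 φ i k)

-- A satisfying assignment ρ of the k-unrolling is read as a word w with w i p = ρ p i.
-- Two facts make this work.  First, a co-safe formula is witnessed within its first k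
-- positions, so the unrolling is sound for every word that agrees with ρ below k,
-- whatever the word does later.  Second, the quantifier blocks translate back: a witness
-- for ∃ p_0 … p_{k-1} changes ρ only on p below k, which is copied into the p-track of
-- the word; and a counterexample word for ∀ p is copied below k into the assignment,
-- which the ∀-block then covers.  Induction on the prefix keeps the invariant that the
-- current word and assignment agree below k.
module Submission where

open import Defs
open import Data.Nat using (ℕ; zero; suc; z≤n; _+_; _∸_; _≤_; _<_; _>_; _≟_; _<?_)
open import Data.Nat.Properties
  using (≤-refl; ≤-trans; <⇒≤; <⇒≱; n≤1+n; +-suc; m+n≤o⇒m≤o; m+[n∸m]≡n; m≤n⇒m<n∨m≡n; ≤∧≢⇒<)
open import Data.Bool using (true; false; _∧_; _∨_; not; if_then_else_)
open import Data.Bool.Properties using (∧-conicalˡ; ∧-conicalʳ; not-¬)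
open import Data.Product using (∃-syntax; _×_; _,_)
open import Data.Sum using (_⊎_; inj₁; inj₂; [_,_])
open import Data.Unit using (tt)
open import Function using (_∘_)
open import Data.List using (_∷_; [])
open import Relation.Nullary using (Dec; does; yes; no; contradiction)
open import Relation.Binary.PropositionalEquality
  using (_≡_; _≢_; refl; sym; trans; cong; cong₂; subst)

∨-true : ∀ a b → a ∨ b ≡ true → a ≡ true ⊎ b ≡ true
∨-true true  b _ = inj₁ refl
∨-true false b e = inj₂ e

_≐_ : Assignment → Assignment → Set
ρ ≐ σ = ∀ q j → ρ q j ≡ σ q j

update-cong : ∀ {ρ σ} p i b → ρ ≐ σ → update ρ p i b ≐ update σ p i b
update-cong p i b ρ≐σ q j = cong (if does (q ≟ p) ∧ does (j ≟ i) then b else_) (ρ≐σ q j)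

eval-cong : ∀ β {ρ σ} → ρ ≐ σ → eval β ρ ≡ eval β σ
eval-cong (bconst b)  ρ≐σ = refl
eval-cong (bvar p i)  ρ≐σ = ρ≐σ p i
eval-cong (bneg p i)  ρ≐σ = cong not (ρ≐σ p i)
eval-cong (β ∨B γ)    ρ≐σ = cong₂ _∨_ (eval-cong β ρ≐σ) (eval-cong γ ρ≐σ)
eval-cong (β ∧B γ)    ρ≐σ = cong₂ _∧_ (eval-cong β ρ≐σ) (eval-cong γ ρ≐σ)
eval-cong (∃B p i β)  ρ≐σ =
  cong₂ _∨_ (eval-cong β (update-cong p i true ρ≐σ)) (eval-cong β (update-cong p i false ρ≐σ))
eval-cong (∀B p i β)  ρ≐σ =
  cong₂ _∧_ (eval-cong β (update-cong p i true ρ≐σ)) (eval-cong β (update-cong p i false ρ≐σ))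

update-same : ∀ ρ p i b → update ρ p i b p i ≡ b
update-same ρ p i b = select (p ≟ p) (i ≟ i)
  where
  select : (p≟p : Dec (p ≡ p)) (i≟i : Dec (i ≡ i)) → (if does p≟p ∧ does i≟i then b else ρ p i) ≡ b
  select (yes _)  (yes _)  = refl
  select (no p≢p) _        = contradiction refl p≢p
  select (yes _)  (no i≢i) = contradiction refl i≢i

update-other : ∀ ρ p i b {q j} → q ≢ p ⊎ j ≢ i → update ρ p i b q j ≡ ρ q j
update-other ρ p i b {q} {j} elsewhere = select (q ≟ p) (j ≟ i)
  where
  select : (q≟p : Dec (q ≡ p)) (j≟i : Dec (j ≡ i)) → (if does q≟p ∧ does j≟i then b else ρ q j) ≡ ρ q j
  select (no _)      _           = refl
  select (yes _)     (no _)      = refl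
  select (yes q≡p)   (yes j≡i) = [ contradiction q≡p , contradiction j≡i ] elsewhere

SameOutside : Prop → ℕ → Assignment → Assignment → Set
SameOutside p n ρ σ = ∀ q j → q ≢ p ⊎ n ≤ j → σ q j ≡ ρ q j

sameOutside-mono : ∀ {p m n ρ σ} → m ≤ n → SameOutside p m ρ σ → SameOutside p n ρ σ
sameOutside-mono m≤n same q j (inj₁ q≢p) = same q j (inj₁ q≢p)
sameOutside-mono m≤n same q j (inj₂ n≤j) = same q j (inj₂ (≤-trans m≤n n≤j))

sameOutside-trans : ∀ {p n ρ σ τ} → SameOutside p n ρ σ → SameOutside p n σ τ → SameOutside p n ρ τ
sameOutside-trans ρσ στ q j outside = trans (στ q j outside) (ρσ q j outside)

sameOutside-update : ∀ ρ p i b → SameOutside p (suc i) ρ (update ρ p i b)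
sameOutside-update ρ p i b q j (inj₁ q≢p)   = update-other ρ p i b (inj₁ q≢p)
sameOutside-update ρ p i b q j (inj₂ 1+i≤j) = update-other ρ p i b (inj₂ λ { refl → <⇒≱ 1+i≤j ≤-refl })

sameOutside-peel : ∀ {p n ρ σ} → SameOutside p (suc n) ρ σ → SameOutside p n (update ρ p n (σ p n)) σ
sameOutside-peel {p} {n} {ρ} {σ} same q j outside with q ≟ p | j ≟ n
... | yes refl | yes refl = sym (update-same ρ p n (σ p n))
... | no q≢p   | _        = trans (same q j (inj₁ q≢p)) (sym (update-other ρ p n _ (inj₁ q≢p)))
... | yes refl | no j≢n   with outside
...   | inj₁ p≢p = contradiction refl p≢p
...   | inj₂ n≤j = trans (same q j (inj₂ (≤∧≢⇒< n≤j (j≢n ∘ sym)))) (sym (update-other ρ p n _ (inj₂ j≢n)))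

eval-∃B : ∀ p i β ρ → eval (∃B p i β) ρ ≡ true → ∃[ b ] eval β (update ρ p i b) ≡ true
eval-∃B p i β ρ holds with eval β (update ρ p i true) in eq
... | true  = true , eq
... | false = false , holds

eval-∀B : ∀ p i β ρ → eval (∀B p i β) ρ ≡ true → ∀ b → eval β (update ρ p i b) ≡ true
eval-∀B p i β ρ holds true  = ∧-conicalˡ _ _ holds
eval-∀B p i β ρ holds false = ∧-conicalʳ _ _ holds

eval-quantAll-∃ : ∀ p n β ρ → eval (quantAll ∃Q p n β) ρ ≡ true →
  ∃[ σ ] (SameOutside p n ρ σ × eval β σ ≡ true)
eval-quantAll-∃ p zero    β ρ holds = ρ , (λ _ _ _ → refl) , holds
eval-quantAll-∃ p (suc n) β ρ holds with eval-∃B p n (quantAll ∃Q p n β) ρ holds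
... | b , holdsᵇ with eval-quantAll-∃ p n β (update ρ p n b) holdsᵇ
...   | σ , same , holdsσ =
  σ , sameOutside-trans (sameOutside-update ρ p n b) (sameOutside-mono (n≤1+n n) same) , holdsσ

eval-quantAll-∀ : ∀ p n β ρ → eval (quantAll ∀Q p n β) ρ ≡ true →
  ∀ σ → SameOutside p n ρ σ → eval β σ ≡ true
eval-quantAll-∀ p zero    β ρ holds σ same = trans (eval-cong β λ q j → same q j (inj₂ z≤n)) holds
eval-quantAll-∀ p (suc n) β ρ holds σ same =
  eval-quantAll-∀ p n β (update ρ p n (σ p n))
    (eval-∀B p n (quantAll ∀Q p n β) ρ holds (σ p n)) σ (sameOutside-peel same)

AgreeBelow : ℕ → Word → Assignment → Set
AgreeBelow k w ρ = ∀ i q → i < k → w i q ≡ ρ q i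

module _ {k : ℕ} {w : Word} {ρ : Assignment} (agree : AgreeBelow k w ρ) where

  unrollU-sound : ∀ (f f' : ℕ → QBF) χ χ' →
    (∀ j → j < k → eval (f j) ρ ≡ true → w , j ⊨ χ) →
    (∀ j → j < k → eval (f' j) ρ ≡ true → w , j ⊨ χ') →
    ∀ n i → i + n ≤ k → eval (unrollU f f' n i) ρ ≡ true → w , i ⊨ (χ Uq χ')
  unrollU-sound f f' χ χ' sound sound' (suc n) i i+1+n≤k holds = unfold (∨-true _ _ holds)
    where
    1+i+n≤k : suc i + n ≤ k
    1+i+n≤k = subst (_≤ k) (+-suc i n) i+1+n≤k
    i<k : i < k
    i<k = m+n≤o⇒m≤o (suc i) 1+i+n≤k
    unfold : eval (f' i) ρ ≡ true ⊎ eval (f i ∧B unrollU f f' n (suc i)) ρ ≡ true →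
      w , i ⊨ (χ Uq χ')
    unfold (inj₁ now) = i , ≤-refl , sound' i i<k now , λ m i≤m m<i → contradiction i≤m (<⇒≱ m<i)
    unfold (inj₂ later)
      with unrollU-sound f f' χ χ' sound sound' n (suc i) 1+i+n≤k (∧-conicalʳ _ _ later)
    ... | j , i<j , holdsʲ , before = j , <⇒≤ i<j , holdsʲ , before'
      where
      before' : ∀ m → i ≤ m → m < j → w , m ⊨ χ
      before' m i≤m m<j with m≤n⇒m<n∨m≡n i≤m
      ... | inj₁ i<m  = before m i<m m<j
      ... | inj₂ refl = sound i i<k (∧-conicalˡ _ _ later)

  qbfφ-sound : ∀ φ i → i < k → eval (qbfφ φ i k) ρ ≡ true → w , i ⊨ toQPTL φ
  qbfφ-sound ctrue    i i<k holds = tt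
  qbfφ-sound (pos p)  i i<k holds = trans (agree i p i<k) holds
  qbfφ-sound (negp p) i i<k holds wᵢp = not-¬ (sym (trans (sym (agree i p i<k)) wᵢp)) (sym holds)
  qbfφ-sound (φ ∨C ψ) i i<k holds with ∨-true _ _ holds
  ... | inj₁ holdsφ = inj₁ (qbfφ-sound φ i i<k holdsφ)
  ... | inj₂ holdsψ = inj₂ (qbfφ-sound ψ i i<k holdsψ)
  qbfφ-sound (φ ∧C ψ) i i<k holds =
    qbfφ-sound φ i i<k (∧-conicalˡ _ _ holds) , qbfφ-sound ψ i i<k (∧-conicalʳ _ _ holds)
  qbfφ-sound (XC φ) i i<k holds with suc i <? k
  ... | yes 1+i<k = qbfφ-sound φ (suc i) 1+i<k holds
  ... | no _      = contradiction holds λ ()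
  qbfφ-sound (φ UC ψ) i i<k holds =
    unrollU-sound (λ j → qbfφ φ j k) (λ j → qbfφ ψ j k) (toQPTL φ) (toQPTL ψ)
      (qbfφ-sound φ) (qbfφ-sound ψ) (k ∸ i) i (subst (_≤ k) (sym (m+[n∸m]≡n (<⇒≤ i<k))) ≤-refl) holds

overrideWord : Prop → Word → Assignment → Word
overrideWord p w σ i q with q ≟ p
... | yes _ = σ q i
... | no _  = w i q

overrideAssignment : Prop → ℕ → Assignment → Word → Assignment
overrideAssignment p k ρ w q j with q ≟ p | j <? k
... | yes _ | yes _ = w j q
... | yes _ | no _  = ρ q j
... | no _  | _     = ρ q j

overrideWord-agreeExcept : ∀ p w σ → AgreeExcept p w (overrideWord p w σ)
overrideWord-agreeExcept p w σ i q q≢p with q ≟ p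
... | yes q≡p = contradiction q≡p q≢p
... | no _    = refl

overrideWord-agreeBelow : ∀ {p k w ρ σ} → AgreeBelow k w ρ → SameOutside p k ρ σ →
  AgreeBelow k (overrideWord p w σ) σ
overrideWord-agreeBelow {p} agree same i q i<k with q ≟ p
... | yes _   = refl
... | no q≢p  = trans (agree i q i<k) (sym (same q i (inj₁ q≢p)))

overrideAssignment-sameOutside : ∀ p k ρ w → SameOutside p k ρ (overrideAssignment p k ρ w)
overrideAssignment-sameOutside p k ρ w q j outside with q ≟ p | j <? k
... | no _     | _     = refl
... | yes _    | no _  = refl
... | yes q≡p  | yes j<k with outside
...   | inj₁ q≢p = contradiction q≡p q≢p
...   | inj₂ k≤j = contradiction k≤j (<⇒≱ j<k)

overrideAssignment-agreeBelow : ∀ {p k w w' ρ} → AgreeBelow k w ρ → AgreeExcept p w w' →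
  AgreeBelow k w' (overrideAssignment p k ρ w')
overrideAssignment-agreeBelow {p} {k} agree differ i q i<k with q ≟ p | i <? k
... | yes _   | yes _   = refl
... | yes _   | no i≮k  = contradiction i<k i≮k
... | no q≢p  | _       = trans (differ i q q≢p) (agree i q i<k)

qbf-sound : ∀ 𝒬 φ {k i} → i < k → ∀ {w ρ} → AgreeBelow k w ρ →
  eval (qbf 𝒬 φ i k) ρ ≡ true → w , i ⊨ prenex 𝒬 φ
qbf-sound [] φ i<k agree holds = qbfφ-sound agree φ _ i<k holds
qbf-sound ((∃Q , p) ∷ 𝒬) φ {k} i<k {w} {ρ} agree holds
  with eval-quantAll-∃ p k _ ρ holds
... | σ , same , holdsσ =
  overrideWord p w σ , overrideWord-agreeExcept p w σ ,
  qbf-sound 𝒬 φ i<k (overrideWord-agreeBelow agree same) holdsσ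
qbf-sound ((∀Q , p) ∷ 𝒬) φ {k} i<k {ρ = ρ} agree holds (w' , differ , w'⊭) =
  w'⊭ (qbf-sound 𝒬 φ i<k (overrideAssignment-agreeBelow agree differ)
         (eval-quantAll-∀ p k _ ρ holds _ (overrideAssignment-sameOutside p k ρ w')))

corollary6p4 : (𝒬 : Prefix) (φ : CoSafe) →
    ∃[ k ] (k > 0 × QBFSatisfiable (qbf 𝒬 φ 0 k)) →
    Satisfiable (prenex 𝒬 φ)
corollary6p4 𝒬 φ (k , k>0 , ρ , holds) = (λ i q → ρ q i) , qbf-sound 𝒬 φ k>0 (λ _ _ _ → refl) holds
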